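{- Let $0<|q|<1$ and for $n\ge 0$ let $A_n(t),B_n(t)$ be the polynomials defined below. Then \[ \Delta_n(t)=\begin{vmatrix}B_n(t)&A_n(t)\\ B_{n+1}(t)&A_{n+1}(t)\end{vmatrix}=C_nt^{2n+1},\qquad C_n=(q^{n+2})_{n+1}(-1)^nq^{\frac{3n^2+n}{2}}\frac{(q)_n}{(q)_{2n+1}}, \] and $C_n\ne 0$.
   Context: $q$-Pochhammer symbols: $(a)_0=1$, $(a)_n=(1-a)(1-aq)\cdots(1-aq^{n-1})$ for $n\ge1$. $q$-binomial coefficients: $\left[{n\atop k}\right]=\frac{(q)_n}{(q)_k(q)_{n-k}}$. The polynomials are \[ B_n(t)=\sum_{k=0}^{n}\left[{n\atop k}\right]q^{\binom{k}{2}}(q^{n+1})_{n-k}(-t)^k,\qquad A_n(t)=\sum_{k=0}^{n}\left[{n\atop k}\right]q^{kn}(q^{n+1})_{n-k}t^k. \] -}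

module Defs where

open import Level using (Level; _⊔_) renaming (suc to lsuc)
open import Data.Nat as ℕ using (ℕ; zero; suc; _∸_)
open import Data.Nat.DivMod using (_/_)
open import Relation.Nullary using (¬_)
open import Algebra.Bundles using (CommutativeRing)

record Field (c ℓ : Level) : Set (lsuc (c ⊔ ℓ)) where
  field
    commutativeRing : CommutativeRing c ℓ
  open CommutativeRing commutativeRing public
  field
    _⁻¹      : Carrier → Carrier
    0≉1      : ¬ (0# ≈ 1#)
    inverseʳ : ∀ x → ¬ (x ≈ 0#) → x * (x ⁻¹) ≈ 1#

module QDefs {c ℓ : Level} (F : Field c ℓ) where
  open Field F

  pow : Carrier → ℕ → Carrier
  pow x zero    = 1#
  pow x (suc n) = x * pow x n

  poch : Carrier → Carrier → ℕ → Carrier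
  poch q a zero    = 1#
  poch q a (suc n) = poch q a n * (1# - a * pow q n)

  sumTo : ℕ → (ℕ → Carrier) → Carrier
  sumTo zero    f = f 0
  sumTo (suc n) f = sumTo n f + f (suc n)

  -- q-binomial coefficient [n k] = (q)_n / ((q)_k (q)_{n-k})  (used for k ≤ n)
  qbinom : Carrier → ℕ → ℕ → Carrier
  qbinom q n k = poch q q n * ((poch q q k * poch q q (n ∸ k)) ⁻¹)

  choose2 : ℕ → ℕ
  choose2 k = (k ℕ.* (k ∸ 1)) / 2

  B : Carrier → ℕ → Carrier → Carrier
  B q n t = sumTo n (λ k →
    qbinom q n k * pow q (choose2 k) * poch q (pow q (suc n)) (n ∸ k) * pow (- t) k)

  A : Carrier → ℕ → Carrier → Carrier
  A q n t = sumTo n (λ k →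
    qbinom q n k * pow q (k ℕ.* n) * poch q (pow q (suc n)) (n ∸ k) * pow t k)

  Δ : Carrier → ℕ → Carrier → Carrier
  Δ q n t = B q n t * A q (suc n) t - A q n t * B q (suc n) t

  C : Carrier → ℕ → Carrier
  C q n = poch q (pow q (2 ℕ.+ n)) (suc n) * pow (- 1#) n
          * pow q ((3 ℕ.* n ℕ.* n ℕ.+ n) / 2)
          * poch q q n * ((poch q q (suc (2 ℕ.* n))) ⁻¹)

module Submission where

-- Writing Z = q^m, both families B_n(t) and A_n(t) satisfy the same
-- three-term recurrence
--   (1 + qZ) y_{m+2} = (a₁(Z) - b₁(Z) t) y_{m+1} + q²Z³(1 + q²Z) t² y_m ,
-- so their Casoratian Δ_m = B_m A_{m+1} - A_m B_{m+1} satisfies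
--   (1 + q^{m+1}) Δ_{m+1} = -q^{3m+2}(1 + q^{m+2}) t² Δ_m .
-- From Δ_0 = (1 + q) t this gives Δ_n = D_n t^{2n+1} with
-- D_n = (-1)^n q^{(3n²+n)/2} (1 + q^{n+1}), and a short q-Pochhammer
-- computation shows D_n = C_n; D_n ≠ 0 because q ≠ 0 is not a root of unity.
--
-- The recurrence is proved coefficientwise: the k-th coefficient of B_n and A_n
-- is a weight (-1)^k q^{k(k-1)/2}, resp. q^{kn}, times (q)_{2n-k}/((q)_k (q)_{n-k}),
-- and in each column the recurrence becomes a polynomial identity in q, q^j, q^d.

open import Defs
open import Level using (Level; _⊔_)
open import Data.Nat as ℕ using (ℕ; zero; suc; _∸_; _≤_; _<_; z≤n; s≤s)
import Data.Nat.Properties as ℕP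
open import Data.Nat.Divisibility using (divides-refl)
open import Data.Nat.DivMod using (_/_; m*n/n≡m; +-distrib-/-∣ˡ)
open import Data.Nat.Tactic.RingSolver using (solve-∀)
open import Data.Product using (_×_; _,_; proj₁; proj₂)
open import Data.Maybe using (Maybe; just; nothing; is-just; to-witness-T)
open import Data.Bool using (T)
open import Data.Vec.N-ary using (N-ary; Eq; curryⁿ; curryⁿ-cong)
open import Relation.Nullary using (¬_; yes; no)
open import Relation.Binary.PropositionalEquality as P using (_≡_)
open import Algebra.Bundles using (RawRing; CommutativeRing)
open import Algebra.Solver.Ring.AlmostCommutativeRing
  using (_-Raw-AlmostCommutative⟶_; fromCommutativeRing)
import Algebra.Solver.CommutativeMonoid as CommutativeMonoidSolver
import Algebra.Solver.Ring as RingSolver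

-- The library solver needs
-- a coefficient ring with weakly decidable equality mapping into R; we take the
-- integers, as formal differences of naturals, so that identities which need
-- cancellation (such as (1 - x)(1 + x) = 1 - x²) can be normalised.
module IntegerRingSolver {c ℓ : Level} (R : CommutativeRing c ℓ) where
  open CommutativeRing R
  open import Relation.Binary.Reasoning.Setoid setoid
  open import Algebra.Properties.Ring ring
    using (-‿+-comm; -‿involutive; -0#≈0#; -‿distribˡ-*; -‿distribʳ-*)
  open import Algebra.Properties.Group +-group using (x∙y⁻¹≈ε⇒x≈y)
  open import Algebra.Properties.Semiring.Mult.TCOptimised semiring
    using (×-homo-+; ×1-homo-*) renaming (_×_ to _·_)
  open CommutativeMonoidSolver +-commutativeMonoid using (solve; _⊜_; _⊕_)

  difference-+ : ∀ x y z w → (x - y) + (z - w) ≈ (x + z) - (y + w)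
  difference-+ x y z w = begin
    (x - y) + (z - w)       ≈⟨ solve 4 (λ x y z w → (x ⊕ y) ⊕ (z ⊕ w) ⊜ (x ⊕ z) ⊕ (y ⊕ w)) refl x (- y) z (- w) ⟩
    (x + z) + (- y + - w)   ≈⟨ +-congˡ (-‿+-comm y w) ⟩
    (x + z) - (y + w)       ∎

  difference-* : ∀ x y z w → (x - y) * (z - w) ≈ (x * z + y * w) - (x * w + y * z)
  difference-* x y z w = begin
    (x - y) * (z - w)                        ≈⟨ distribʳ (z - w) x (- y) ⟩
    x * (z - w) + - y * (z - w)              ≈⟨ +-cong (distribˡ x z (- w)) (distribˡ (- y) z (- w)) ⟩
    (x * z + x * - w) + (- y * z + - y * - w) ≈⟨ +-cong (+-congˡ (sym (-‿distribʳ-* x w)))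
                                                  (+-cong (sym (-‿distribˡ-* y z)) negated-twice) ⟩
    (x * z - x * w) + (- (y * z) + y * w)    ≈⟨ solve 4 (λ a b c d → (a ⊕ b) ⊕ (c ⊕ d) ⊜ (a ⊕ d) ⊕ (b ⊕ c))
                                                  refl (x * z) (- (x * w)) (- (y * z)) (y * w) ⟩
    (x * z + y * w) + (- (x * w) + - (y * z)) ≈⟨ +-congˡ (-‿+-comm (x * w) (y * z)) ⟩
    (x * z + y * w) - (x * w + y * z)        ∎
    where
    negated-twice : - y * - w ≈ y * w
    negated-twice = trans (sym (-‿distribˡ-* y (- w)))
                      (trans (-‿cong (sym (-‿distribʳ-* y w))) (-‿involutive (y * w)))

  difference-neg : ∀ x y → y - x ≈ - (x - y)
  difference-neg x y = begin
    y - x         ≈⟨ +-comm y (- x) ⟩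
    - x + y       ≈⟨ +-congˡ (sym (-‿involutive y)) ⟩
    - x + - - y   ≈⟨ -‿+-comm x (- y) ⟩
    - (x - y)     ∎

  difference-cong : ∀ x y z w → x + w ≈ z + y → x - y ≈ z - w
  difference-cong x y z w eq = x∙y⁻¹≈ε⇒x≈y (x - y) (z - w) (begin
    (x - y) - (z - w)           ≈⟨ +-congˡ (sym (difference-neg z w)) ⟩
    (x - y) + (w - z)           ≈⟨ difference-+ x y w z ⟩
    (x + w) - (y + z)           ≈⟨ +-cong eq (-‿cong (+-comm y z)) ⟩
    (z + y) - (z + y)           ≈⟨ -‿inverseʳ (z + y) ⟩
    0#                          ∎)

  ℤ-differences : RawRing _ _
  ℤ-differences = record
    { Carrier = ℕ × ℕ ; _≈_ = _≡_
    ; _+_ = λ { (a , b) (c , d) → (a ℕ.+ c , b ℕ.+ d) }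
    ; _*_ = λ { (a , b) (c , d) → (a ℕ.* c ℕ.+ b ℕ.* d , a ℕ.* d ℕ.+ b ℕ.* c) }
    ; -_ = λ { (a , b) → (b , a) }
    ; 0# = (0 , 0) ; 1# = (1 , 0) }

  -- The canonical map into R; nonnegative constants map to a plain
  -- multiple of 1#, so that 1 denotes 1# on the nose.
  embed : ℕ × ℕ → Carrier
  embed (a , zero)  = a · 1#
  embed (a , suc b) = a · 1# - suc b · 1#

  embed-difference : ∀ a b → embed (a , b) ≈ a · 1# - b · 1#
  embed-difference a zero    = sym (trans (+-congˡ -0#≈0#) (+-identityʳ (a · 1#)))
  embed-difference a (suc b) = refl

  embed-homomorphism : ℤ-differences -Raw-AlmostCommutative⟶ fromCommutativeRing R
  embed-homomorphism = record
    { ⟦_⟧    = embed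
    ; +-homo = λ { (a , b) (c , d) → begin
        embed (a ℕ.+ c , b ℕ.+ d)                  ≈⟨ embed-difference (a ℕ.+ c) (b ℕ.+ d) ⟩
        (a ℕ.+ c) · 1# - (b ℕ.+ d) · 1#            ≈⟨ +-cong (×-homo-+ 1# a c) (-‿cong (×-homo-+ 1# b d)) ⟩
        (a · 1# + c · 1#) - (b · 1# + d · 1#)      ≈⟨ difference-+ _ _ _ _ ⟨
        (a · 1# - b · 1#) + (c · 1# - d · 1#)      ≈⟨ +-cong (embed-difference a b) (embed-difference c d) ⟨
        embed (a , b) + embed (c , d)              ∎ }
    ; *-homo = λ { (a , b) (c , d) → begin
        embed (a ℕ.* c ℕ.+ b ℕ.* d , a ℕ.* d ℕ.+ b ℕ.* c) ≈⟨ embed-difference (a ℕ.* c ℕ.+ b ℕ.* d) (a ℕ.* d ℕ.+ b ℕ.* c) ⟩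
        (a ℕ.* c ℕ.+ b ℕ.* d) · 1# - (a ℕ.* d ℕ.+ b ℕ.* c) · 1#
          ≈⟨ +-cong (trans (×-homo-+ 1# (a ℕ.* c) (b ℕ.* d)) (+-cong (×1-homo-* a c) (×1-homo-* b d)))
                    (-‿cong (trans (×-homo-+ 1# (a ℕ.* d) (b ℕ.* c)) (+-cong (×1-homo-* a d) (×1-homo-* b c)))) ⟩
        (a · 1# * (c · 1#) + b · 1# * (d · 1#)) - (a · 1# * (d · 1#) + b · 1# * (c · 1#))
          ≈⟨ difference-* _ _ _ _ ⟨
        (a · 1# - b · 1#) * (c · 1# - d · 1#)     ≈⟨ *-cong (embed-difference a b) (embed-difference c d) ⟨
        embed (a , b) * embed (c , d)               ∎ }
    ; -‿homo = λ { (a , b) → begin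
        embed (b , a)          ≈⟨ embed-difference b a ⟩
        b · 1# - a · 1#        ≈⟨ difference-neg _ _ ⟩
        - (a · 1# - b · 1#)    ≈⟨ -‿cong (embed-difference a b) ⟨
        - embed (a , b)        ∎ }
    ; 0-homo = refl
    ; 1-homo = refl }

  coefficient-equality : ∀ x y → Maybe (embed x ≈ embed y)
  coefficient-equality (a , b) (c , d) with a ℕ.+ d ℕ.≟ c ℕ.+ b
  ... | no _  = nothing
  ... | yes e = just (begin
    embed (a , b)       ≈⟨ embed-difference a b ⟩
    a · 1# - b · 1#     ≈⟨ difference-cong _ _ _ _ (begin
                             a · 1# + d · 1#    ≈⟨ ×-homo-+ 1# a d ⟨
                             (a ℕ.+ d) · 1#     ≡⟨ P.cong (_· 1#) e ⟩
                             (c ℕ.+ b) · 1#     ≈⟨ ×-homo-+ 1# c b ⟩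
                             c · 1# + b · 1#    ∎) ⟩
    c · 1# - d · 1#     ≈⟨ embed-difference c d ⟨
    embed (c , d)       ∎)

  open RingSolver ℤ-differences (fromCommutativeRing R) embed-homomorphism coefficient-equality public
    using (Polynomial; con; var; _:+_; _:*_; _:-_; :-_; _:=_; normalise; _≟N_; ⟦_⟧; ⟦_⟧↓; correct; ⟦_⟧N-cong)
  open import Relation.Binary.Reflection setoid var ⟦_⟧ ⟦_⟧↓ correct using (close; prove)

  one : ∀ {n} → Polynomial n
  one = con (1 , 0)

  ring-identity : ∀ n (f : N-ary n (Polynomial n) (Polynomial n × Polynomial n)) →
         {_ : T (is-just (normalise (proj₁ (close n f)) ≟N normalise (proj₂ (close n f))))} →
         Eq n _≈_ (curryⁿ ⟦ proj₁ (close n f) ⟧) (curryⁿ ⟦ proj₂ (close n f) ⟧)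
  ring-identity n f {same} = curryⁿ-cong _≈_ ⟦ proj₁ (close n f) ⟧ ⟦ proj₂ (close n f) ⟧ λ ρ →
    prove ρ (proj₁ (close n f)) (proj₂ (close n f)) (⟦ to-witness-T _ same ⟧N-cong ρ)


module FieldFacts {c ℓ : Level} (F : Field c ℓ) where
  open Field F
  open import Relation.Binary.Reasoning.Setoid setoid
  open import Algebra.Properties.Ring ring using (-‿involutive; -0#≈0#)

  inverseˡ : ∀ x → ¬ (x ≈ 0#) → x ⁻¹ * x ≈ 1#
  inverseˡ x x≉0 = trans (*-comm (x ⁻¹) x) (inverseʳ x x≉0)

  *-cancelˡ : ∀ {u x y} → ¬ (u ≈ 0#) → u * x ≈ u * y → x ≈ y
  *-cancelˡ {u} {x} {y} u≉0 ux≈uy = begin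
    x                  ≈⟨ *-identityˡ x ⟨
    1# * x             ≈⟨ *-congʳ (inverseˡ u u≉0) ⟨
    (u ⁻¹ * u) * x     ≈⟨ *-assoc (u ⁻¹) u x ⟩
    u ⁻¹ * (u * x)     ≈⟨ *-congˡ ux≈uy ⟩
    u ⁻¹ * (u * y)     ≈⟨ *-assoc (u ⁻¹) u y ⟨
    (u ⁻¹ * u) * y     ≈⟨ *-congʳ (inverseˡ u u≉0) ⟩
    1# * y             ≈⟨ *-identityˡ y ⟩
    y                  ∎

  nonzero-* : ∀ {x y} → ¬ (x ≈ 0#) → ¬ (y ≈ 0#) → ¬ (x * y ≈ 0#)
  nonzero-* {x} {y} x≉0 y≉0 xy≈0 = y≉0 (*-cancelˡ x≉0 (trans xy≈0 (sym (zeroʳ x))))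

  1≉0 : ¬ (1# ≈ 0#)
  1≉0 1≈0 = 0≉1 (sym 1≈0)

  -1≉0 : ¬ (- 1# ≈ 0#)
  -1≉0 -1≈0 = 1≉0 (trans (sym (-‿involutive 1#)) (trans (-‿cong -1≈0) -0#≈0#))

  inverse-unique : ∀ {x y} → ¬ (x ≈ 0#) → x * y ≈ 1# → y ≈ x ⁻¹
  inverse-unique {x} x≉0 xy≈1 = *-cancelˡ x≉0 (trans xy≈1 (sym (inverseʳ x x≉0)))

  inverse-* : ∀ {x y} → ¬ (x ≈ 0#) → ¬ (y ≈ 0#) → (x * y) ⁻¹ ≈ x ⁻¹ * y ⁻¹
  inverse-* {x} {y} x≉0 y≉0 = sym (inverse-unique (nonzero-* x≉0 y≉0) (begin
    (x * y) * (x ⁻¹ * y ⁻¹)     ≈⟨ *-assoc x y (x ⁻¹ * y ⁻¹) ⟩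
    x * (y * (x ⁻¹ * y ⁻¹))     ≈⟨ *-congˡ (x∙yz≈y∙xz y (x ⁻¹) (y ⁻¹)) ⟩
    x * (x ⁻¹ * (y * y ⁻¹))     ≈⟨ *-assoc x (x ⁻¹) (y * y ⁻¹) ⟨
    (x * x ⁻¹) * (y * y ⁻¹)     ≈⟨ *-cong (inverseʳ x x≉0) (inverseʳ y y≉0) ⟩
    1# * 1#                     ≈⟨ *-identityˡ 1# ⟩
    1#                          ∎))
    where open import Algebra.Properties.CommutativeSemigroup *-commutativeSemigroup using (x∙yz≈y∙xz)

  *-inverse-of-equal : ∀ {x y} → x ≈ y → ¬ (y ≈ 0#) → x * y ⁻¹ ≈ 1#
  *-inverse-of-equal {x} {y} x≈y y≉0 = trans (*-congʳ x≈y) (inverseʳ y y≉0)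

module PowersAndSums {c ℓ : Level} (F : Field c ℓ) where
  open Field F
  open QDefs F
  open FieldFacts F
  open IntegerRingSolver commutativeRing
  open import Relation.Binary.Reasoning.Setoid setoid
  open import Algebra.Properties.Ring ring using (-1*x≈-x)

  pow-cong : ∀ {x y} k → x ≈ y → pow x k ≈ pow y k
  pow-cong zero    x≈y = refl
  pow-cong (suc k) x≈y = *-cong x≈y (pow-cong k x≈y)

  pow-≡ : ∀ x {a b} → a ≡ b → pow x a ≈ pow x b
  pow-≡ x a≡b = reflexive (P.cong (pow x) a≡b)

  pow-+ : ∀ x a b → pow x (a ℕ.+ b) ≈ pow x a * pow x b
  pow-+ x zero    b = sym (*-identityˡ (pow x b))
  pow-+ x (suc a) b = trans (*-congˡ (pow-+ x a b)) (sym (*-assoc x (pow x a) (pow x b)))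

  pow-affine : ∀ x j s c → pow x (s ℕ.* j ℕ.+ c) ≈ pow (pow x j) s * pow x c
  pow-affine x j zero    c = sym (*-identityˡ (pow x c))
  pow-affine x j (suc s) c = begin
    pow x (j ℕ.+ s ℕ.* j ℕ.+ c)              ≡⟨ P.cong (pow x) (ℕP.+-assoc j (s ℕ.* j) c) ⟩
    pow x (j ℕ.+ (s ℕ.* j ℕ.+ c))            ≈⟨ pow-+ x j (s ℕ.* j ℕ.+ c) ⟩
    pow x j * pow x (s ℕ.* j ℕ.+ c)          ≈⟨ *-congˡ (pow-affine x j s c) ⟩
    pow x j * (pow (pow x j) s * pow x c)    ≈⟨ *-assoc (pow x j) _ _ ⟨
    pow (pow x j) (suc s) * pow x c          ∎

  pow-distrib : ∀ x y k → pow (x * y) k ≈ pow x k * pow y k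
  pow-distrib x y zero    = sym (*-identityˡ 1#)
  pow-distrib x y (suc k) = begin
    (x * y) * pow (x * y) k           ≈⟨ *-congˡ (pow-distrib x y k) ⟩
    (x * y) * (pow x k * pow y k)     ≈⟨ ring-identity 4 (λ x y a b → (x :* y) :* (a :* b) := (x :* a) :* (y :* b)) x y (pow x k) (pow y k) ⟩
    (x * pow x k) * (y * pow y k)     ∎

  pow-negate : ∀ t k → pow (- t) k ≈ pow (- 1#) k * pow t k
  pow-negate t k = trans (pow-cong k (sym (-1*x≈-x t))) (pow-distrib (- 1#) t k)

  pow-nonzero : ∀ {x} k → ¬ (x ≈ 0#) → ¬ (pow x k ≈ 0#)
  pow-nonzero zero    x≉0 = 1≉0
  pow-nonzero (suc k) x≉0 = nonzero-* x≉0 (pow-nonzero k x≉0)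

  Pow : ∀ {n} → Polynomial n → ℕ → Polynomial n
  Pow x zero    = one
  Pow x (suc k) = x :* Pow x k

  Poch : ∀ {n} → Polynomial n → Polynomial n → ℕ → Polynomial n
  Poch q a zero    = one
  Poch q a (suc k) = Poch q a k :* (one :- a :* Pow q k)

  poch-cong : ∀ x k {a b} → a ≈ b → poch x a k ≈ poch x b k
  poch-cong x zero    a≈b = refl
  poch-cong x (suc k) a≈b = *-cong (poch-cong x k a≈b) (+-congˡ (-‿cong (*-congʳ a≈b)))

  sumTo-cong : ∀ N {f g : ℕ → Carrier} → (∀ k → k ≤ N → f k ≈ g k) → sumTo N f ≈ sumTo N g
  sumTo-cong zero    f≈g = f≈g 0 z≤n
  sumTo-cong (suc N) f≈g =
    +-cong (sumTo-cong N (λ k k≤N → f≈g k (ℕP.m≤n⇒m≤1+n k≤N))) (f≈g (suc N) ℕP.≤-refl)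

  sumTo-+ : ∀ N (f g : ℕ → Carrier) → sumTo N (λ k → f k + g k) ≈ sumTo N f + sumTo N g
  sumTo-+ zero    f g = refl
  sumTo-+ (suc N) f g = trans (+-congʳ (sumTo-+ N f g))
    (ring-identity 4 (λ a b c d → (a :+ b) :+ (c :+ d) := (a :+ c) :+ (b :+ d))
      (sumTo N f) (sumTo N g) (f (suc N)) (g (suc N)))

  sumTo-scale : ∀ N a (f : ℕ → Carrier) → sumTo N (λ k → a * f k) ≈ a * sumTo N f
  sumTo-scale zero    a f = refl
  sumTo-scale (suc N) a f = trans (+-congʳ (sumTo-scale N a f)) (sym (distribˡ a _ _))

  sumTo-head : ∀ N (f : ℕ → Carrier) → sumTo (suc N) f ≈ f 0 + sumTo N (λ k → f (suc k))
  sumTo-head zero    f = refl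
  sumTo-head (suc N) f = trans (+-congʳ (sumTo-head N f)) (+-assoc _ _ _)

  ev : ℕ → (ℕ → Carrier) → Carrier → Carrier
  ev N c t = sumTo N (λ k → c k * pow t k)

  shift : (ℕ → Carrier) → ℕ → Carrier
  shift c zero    = 0#
  shift c (suc k) = c k

  ev-cong : ∀ N {c d : ℕ → Carrier} t → (∀ k → c k ≈ d k) → ev N c t ≈ ev N d t
  ev-cong N t c≈d = sumTo-cong N (λ k _ → *-congʳ (c≈d k))

  ev-shift : ∀ N c t → t * ev N c t ≈ ev (suc N) (shift c) t
  ev-shift N c t = sym (begin
    ev (suc N) (shift c) t                             ≈⟨ sumTo-head N _ ⟩
    0# * 1# + sumTo N (λ k → c k * (t * pow t k))      ≈⟨ +-cong (zeroˡ 1#) (sumTo-cong N λ k _ →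
                                                            ring-identity 3 (λ a t p → a :* (t :* p) := t :* (a :* p)) (c k) t (pow t k)) ⟩
    0# + sumTo N (λ k → t * (c k * pow t k))           ≈⟨ +-identityˡ _ ⟩
    sumTo N (λ k → t * (c k * pow t k))                ≈⟨ sumTo-scale N t _ ⟩
    t * ev N c t                                       ∎)

  ev-drop-top : ∀ N c t → c (suc N) ≈ 0# → ev (suc N) c t ≈ ev N c t
  ev-drop-top N c t top≈0 = trans (+-congˡ (trans (*-congʳ top≈0) (zeroˡ _))) (+-identityʳ _)

  ev-scale : ∀ N a c t → ev N (λ k → a * c k) t ≈ a * ev N c t
  ev-scale N a c t = trans (sumTo-cong N (λ k _ → *-assoc a (c k) (pow t k))) (sumTo-scale N a _)

  ev-+ : ∀ N c d t → ev N (λ k → c k + d k) t ≈ ev N c t + ev N d t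
  ev-+ N c d t = trans (sumTo-cong N (λ k _ → distribʳ (pow t k) (c k) (d k))) (sumTo-+ N _ _)

  recurrence-from-coefficients :
    ∀ m (u a g b : Carrier) (c₀ c₁ c₂ : ℕ → Carrier) → c₁ (suc (suc m)) ≈ 0# →
    (∀ k → u * c₂ k ≈ a * c₁ k + g * shift c₁ k + b * shift (shift c₀) k) → ∀ t →
    u * ev (suc (suc m)) c₂ t ≈ (a + g * t) * ev (suc m) c₁ t + b * (t * t) * ev m c₀ t
  recurrence-from-coefficients m u a g b c₀ c₁ c₂ top≈0 rec t = begin
    u * ev (2+m) c₂ t
      ≈⟨ ev-scale (2+m) u c₂ t ⟨
    ev (2+m) (λ k → u * c₂ k) t
      ≈⟨ ev-cong (2+m) t rec ⟩
    ev (2+m) (λ k → a * c₁ k + g * shift c₁ k + b * shift (shift c₀) k) t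
      ≈⟨ trans (ev-+ (2+m) _ _ t) (+-congʳ (ev-+ (2+m) _ _ t)) ⟩
    ev (2+m) (λ k → a * c₁ k) t + ev (2+m) (λ k → g * shift c₁ k) t + ev (2+m) (λ k → b * shift (shift c₀) k) t
      ≈⟨ +-cong (+-cong (ev-scale (2+m) a c₁ t) (ev-scale (2+m) g _ t)) (ev-scale (2+m) b _ t) ⟩
    a * ev (2+m) c₁ t + g * ev (2+m) (shift c₁) t + b * ev (2+m) (shift (shift c₀)) t
      ≈⟨ +-cong (+-cong (*-congˡ (ev-drop-top (suc m) c₁ t top≈0)) (*-congˡ (sym (ev-shift (suc m) c₁ t))))
                (*-congˡ (trans (sym (ev-shift (suc m) (shift c₀) t)) (*-congˡ (sym (ev-shift m c₀ t))))) ⟩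
    a * E₁ + g * (t * E₁) + b * (t * (t * E₀))
      ≈⟨ ring-identity 6 (λ a g b t E₁ E₀ → a :* E₁ :+ g :* (t :* E₁) :+ b :* (t :* (t :* E₀))
                                         := (a :+ g :* t) :* E₁ :+ b :* (t :* t) :* E₀) a g b t E₁ E₀ ⟩
    (a + g * t) * E₁ + b * (t * t) * E₀ ∎
    where
    2+m = suc (suc m)
    E₁ = ev (suc m) c₁ t
    E₀ = ev m c₀ t

casoratian-step : ∀ {c ℓ} (R : CommutativeRing c ℓ) → let open CommutativeRing R in
  ∀ {u α β y₀ y₁ y₂ z₀ z₁ z₂} → u * y₂ ≈ α * y₁ + β * y₀ → u * z₂ ≈ α * z₁ + β * z₀ →
  u * (y₁ * z₂ - z₁ * y₂) ≈ - β * (y₀ * z₁ - z₀ * y₁)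
casoratian-step R {u} {α} {β} {y₀} {y₁} {y₂} {z₀} {z₁} {z₂} rec-y rec-z = begin
  u * (y₁ * z₂ - z₁ * y₂)                          ≈⟨ ring-identity 5 (λ u y₁ z₂ z₁ y₂ → u :* (y₁ :* z₂ :- z₁ :* y₂)
                                                       := y₁ :* (u :* z₂) :- z₁ :* (u :* y₂)) u y₁ z₂ z₁ y₂ ⟩
  y₁ * (u * z₂) - z₁ * (u * y₂)                    ≈⟨ +-cong (*-congˡ rec-z) (-‿cong (*-congˡ rec-y)) ⟩
  y₁ * (α * z₁ + β * z₀) - z₁ * (α * y₁ + β * y₀)  ≈⟨ ring-identity 6 (λ α β y₀ y₁ z₀ z₁ →
                                                       y₁ :* (α :* z₁ :+ β :* z₀) :- z₁ :* (α :* y₁ :+ β :* y₀)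
                                                       := :- β :* (y₀ :* z₁ :- z₀ :* y₁)) α β y₀ y₁ z₀ z₁ ⟩
  - β * (y₀ * z₁ - z₀ * y₁)                        ∎
  where
  open CommutativeRing R
  open IntegerRingSolver R
  open import Relation.Binary.Reasoning.Setoid setoid

halve-shift : ∀ k x → (k ℕ.* 2 ℕ.+ x) / 2 ≡ k ℕ.+ x / 2
halve-shift k x = P.trans (+-distrib-/-∣ˡ x (divides-refl k)) (P.cong (ℕ._+ x / 2) (m*n/n≡m k 2))

choose2-suc : ∀ k → (suc k ℕ.* (suc k ∸ 1)) / 2 ≡ k ℕ.+ (k ℕ.* (k ∸ 1)) / 2
choose2-suc zero    = P.refl
choose2-suc (suc k) = P.trans (P.cong (_/ 2) (double k)) (halve-shift (suc k) (suc k ℕ.* k))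
  where
  double : ∀ k → suc (suc k) ℕ.* suc k ≡ suc k ℕ.* 2 ℕ.+ suc k ℕ.* k
  double = solve-∀

pentagonal-suc : ∀ n → (3 ℕ.* suc n ℕ.* suc n ℕ.+ suc n) / 2 ≡ (3 ℕ.* n ℕ.+ 2) ℕ.+ (3 ℕ.* n ℕ.* n ℕ.+ n) / 2
pentagonal-suc n = P.trans (P.cong (_/ 2) (expand n)) (halve-shift (3 ℕ.* n ℕ.+ 2) (3 ℕ.* n ℕ.* n ℕ.+ n))
  where
  expand : ∀ n → 3 ℕ.* suc n ℕ.* suc n ℕ.+ suc n ≡ (3 ℕ.* n ℕ.+ 2) ℕ.* 2 ℕ.+ (3 ℕ.* n ℕ.* n ℕ.+ n)
  expand = solve-∀

∸-index : ∀ {a} j x → a ≡ j ℕ.+ x → a ∸ j ≡ x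
∸-index j x a≡j+x = P.trans (P.cong (_∸ j) a≡j+x) (ℕP.m+n∸m≡n j x)

module QCalculus {c ℓ : Level} (F : Field c ℓ) (q : Field.Carrier F)
  (q≉0 : ¬ (Field._≈_ F q (Field.0# F)))
  (q^k≉1 : ∀ k → ¬ (Field._≈_ F (QDefs.pow F q (suc k)) (Field.1# F))) where
  open Field F
  open QDefs F
  open FieldFacts F
  open PowersAndSums F
  open IntegerRingSolver commutativeRing
  open import Relation.Binary.Reasoning.Setoid setoid
  open import Algebra.Properties.Group +-group using (x∙y⁻¹≈ε⇒x≈y)

  qfac : ℕ → Carrier
  qfac = poch q q

  qfac⁻¹ : ℕ → Carrier
  qfac⁻¹ m = qfac m ⁻¹

  qfac-≡ : ∀ {a b} → a ≡ b → qfac a ≈ qfac b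
  qfac-≡ a≡b = reflexive (P.cong qfac a≡b)

  1-q^k≉0 : ∀ k → ¬ (1# - pow q (suc k) ≈ 0#)
  1-q^k≉0 k 1-q^k≈0 = q^k≉1 k (sym (x∙y⁻¹≈ε⇒x≈y 1# (pow q (suc k)) 1-q^k≈0))

  -- 1 + q^{k+1} ≠ 0, because (1 - q^{k+1})(1 + q^{k+1}) = 1 - q^{2k+2} ≠ 0.
  1+q^k≉0 : ∀ k → ¬ (1# + pow q (suc k) ≈ 0#)
  1+q^k≉0 k 1+q^k≈0 = 1-q^k≉0 (k ℕ.+ suc k) (begin
    1# - pow q (suc k ℕ.+ suc k)                ≈⟨ +-congˡ (-‿cong (pow-+ q (suc k) (suc k))) ⟩
    1# - K * K                                  ≈⟨ ring-identity 1 (λ K → one :- K :* K := (one :- K) :* (one :+ K)) K ⟩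
    (1# - K) * (1# + K)                         ≈⟨ *-congˡ 1+q^k≈0 ⟩
    (1# - K) * 0#                               ≈⟨ zeroʳ (1# - K) ⟩
    0#                                          ∎)
    where K = pow q (suc k)

  qfac≉0 : ∀ m → ¬ (qfac m ≈ 0#)
  qfac≉0 zero    = 1≉0
  qfac≉0 (suc m) = nonzero-* (qfac≉0 m) (1-q^k≉0 m)

  qfac-shift : ∀ a b → qfac a * poch q (pow q (suc a)) b ≈ qfac (a ℕ.+ b)
  qfac-shift a zero    = trans (*-identityʳ (qfac a)) (qfac-≡ (P.sym (ℕP.+-identityʳ a)))
  qfac-shift a (suc b) = begin
    qfac a * (poch q (pow q (suc a)) b * (1# - pow q (suc a) * pow q b))
      ≈⟨ *-assoc (qfac a) _ _ ⟨
    qfac a * poch q (pow q (suc a)) b * (1# - pow q (suc a) * pow q b)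
      ≈⟨ *-cong (qfac-shift a b) (+-congˡ (-‿cong (trans (*-assoc q (pow q a) (pow q b)) (*-congˡ (sym (pow-+ q a b)))))) ⟩
    qfac (a ℕ.+ b) * (1# - q * pow q (a ℕ.+ b))
      ≈⟨ qfac-≡ (P.sym (ℕP.+-suc a b)) ⟩
    qfac (a ℕ.+ suc b) ∎

  qfac⁻¹-step : ∀ m → qfac⁻¹ m ≈ qfac⁻¹ (suc m) * (1# - pow q (suc m))
  qfac⁻¹-step m = begin
    qfac⁻¹ m                 ≈⟨ *-identityʳ (qfac⁻¹ m) ⟨
    qfac⁻¹ m * 1#            ≈⟨ *-congˡ (inverseˡ Q (1-q^k≉0 m)) ⟨
    qfac⁻¹ m * (Q ⁻¹ * Q)    ≈⟨ *-assoc (qfac⁻¹ m) (Q ⁻¹) Q ⟨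
    qfac⁻¹ m * Q ⁻¹ * Q      ≈⟨ *-congʳ (inverse-* (qfac≉0 m) (1-q^k≉0 m)) ⟨
    qfac⁻¹ (suc m) * Q       ∎
    where Q = 1# - pow q (suc m)

  qfac⁻¹-step₂ : ∀ j → qfac⁻¹ j ≈ qfac⁻¹ (suc (suc j)) * (1# - pow q (suc (suc j))) * (1# - pow q (suc j))
  qfac⁻¹-step₂ j = trans (qfac⁻¹-step j) (*-congʳ (qfac⁻¹-step (suc j)))

  qbinom-zero : ∀ n → qbinom q n 0 ≈ 1#
  qbinom-zero n = *-inverse-of-equal (sym (*-identityˡ (qfac n))) (nonzero-* 1≉0 (qfac≉0 n))

  qbinom-diagonal : ∀ n → qbinom q n n ≈ 1#
  qbinom-diagonal n = *-inverse-of-equal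
    (sym (trans (*-congˡ (qfac-≡ (ℕP.n∸n≡0 n))) (*-identityʳ (qfac n))))
    (nonzero-* (qfac≉0 n) (qfac≉0 (n ∸ n)))

  -- truncInv n k = 1/(q)_{n-k} for k ≤ n, and 0 for k > n.
  truncInv : ℕ → ℕ → Carrier
  truncInv n       zero    = qfac⁻¹ n
  truncInv zero    (suc k) = 0#
  truncInv (suc n) (suc k) = truncInv n k

  truncInv-above : ∀ {n k} → n < k → truncInv n k ≡ 0#
  truncInv-above {zero}  {suc k} _         = P.refl
  truncInv-above {suc n} {suc k} (s≤s n<k) = truncInv-above n<k

  truncInv-below : ∀ {n k} → k ≤ n → truncInv n k ≡ qfac⁻¹ (n ∸ k)
  truncInv-below {n}     {zero}  _         = P.refl
  truncInv-below {suc n} {suc k} (s≤s k≤n) = truncInv-below k≤n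

  truncInv-step : ∀ n k → truncInv n (suc k) ≈ (1# - pow q (n ∸ k)) * truncInv n k
  truncInv-step zero    zero    = sym (trans (*-congʳ (-‿inverseʳ 1#)) (zeroˡ _))
  truncInv-step zero    (suc k) = sym (zeroʳ _)
  truncInv-step (suc n) zero    = trans (qfac⁻¹-step n) (*-comm _ _)
  truncInv-step (suc n) (suc k) = truncInv-step n k

  -- The coefficients of B_n and A_n are  weight × (q)_{2n-k} / ((q)_k (q)_{n-k}).
  -- The second factor is the "shape", extended by zero for k > n.
  shape : ℕ → ℕ → Carrier
  shape n k = qfac (n ℕ.+ n ∸ k) * qfac⁻¹ k * truncInv n k

  coeff : (ℕ → ℕ → Carrier) → ℕ → ℕ → Carrier
  coeff σ n k = σ n k * shape n k

  coeff-above : ∀ σ {n k} → n < k → coeff σ n k ≈ 0#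
  coeff-above σ {n} {k} n<k =
    trans (*-congˡ (trans (*-congˡ (reflexive (truncInv-above n<k))) (zeroʳ _))) (zeroʳ (σ n k))

  binomial-shape : ∀ n k → k ≤ n → qbinom q n k * poch q (pow q (suc n)) (n ∸ k) ≈ shape n k
  binomial-shape n k k≤n = begin
    qfac n * (qfac k * qfac (n ∸ k)) ⁻¹ * p
      ≈⟨ *-congʳ (*-congˡ (inverse-* (qfac≉0 k) (qfac≉0 (n ∸ k)))) ⟩
    qfac n * (qfac⁻¹ k * qfac⁻¹ (n ∸ k)) * p
      ≈⟨ ring-identity 4 (λ a b c p → a :* (b :* c) :* p := a :* p :* b :* c) (qfac n) (qfac⁻¹ k) (qfac⁻¹ (n ∸ k)) p ⟩
    qfac n * p * qfac⁻¹ k * qfac⁻¹ (n ∸ k)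
      ≈⟨ *-cong (*-congʳ (trans (qfac-shift n (n ∸ k)) (qfac-≡ (P.sym (ℕP.+-∸-assoc n k≤n)))))
                (reflexive (P.sym (truncInv-below k≤n))) ⟩
    shape n k ∎
    where p = poch q (pow q (suc n)) (n ∸ k)

  σB σA : ℕ → ℕ → Carrier
  σB n k = pow (- 1#) k * pow q (choose2 k)
  σA n k = pow q (k ℕ.* n)

  B-expansion : ∀ n t → B q n t ≈ ev n (coeff σB n) t
  B-expansion n t = sumTo-cong n term
    where
    term : ∀ k → k ≤ n → qbinom q n k * pow q (choose2 k) * poch q (pow q (suc n)) (n ∸ k) * pow (- t) k
                         ≈ coeff σB n k * pow t k
    term k k≤n = begin
      b * e * p * pow (- t) k      ≈⟨ *-congˡ (pow-negate t k) ⟩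
      b * e * p * (s * pow t k)    ≈⟨ ring-identity 5 (λ b e p s T → b :* e :* p :* (s :* T) := s :* e :* (b :* p) :* T)
                                        b e p s (pow t k) ⟩
      s * e * (b * p) * pow t k    ≈⟨ *-congʳ (*-congˡ (binomial-shape n k k≤n)) ⟩
      coeff σB n k * pow t k       ∎
      where
      b = qbinom q n k
      e = pow q (choose2 k)
      p = poch q (pow q (suc n)) (n ∸ k)
      s = pow (- 1#) k

  A-expansion : ∀ n t → A q n t ≈ ev n (coeff σA n) t
  A-expansion n t = sumTo-cong n term
    where
    term : ∀ k → k ≤ n → qbinom q n k * pow q (k ℕ.* n) * poch q (pow q (suc n)) (n ∸ k) * pow t k
                         ≈ coeff σA n k * pow t k
    term k k≤n = begin
      b * e * p * pow t k          ≈⟨ ring-identity 4 (λ b e p T → b :* e :* p :* T := e :* (b :* p) :* T) b e p (pow t k) ⟩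
      e * (b * p) * pow t k        ≈⟨ *-congʳ (*-congˡ (binomial-shape n k k≤n)) ⟩
      coeff σA n k * pow t k       ∎
      where
      b = qbinom q n k
      e = pow q (k ℕ.* n)
      p = poch q (pow q (suc n)) (n ∸ k)

  -- Both B_n and A_n satisfy, with Z = q^m,
  --   a₂ y_{m+2} = (a₁ - b₁ t) y_{m+1} + a₀ t² y_m.
  a₂ a₁ b₁ a₀ : Carrier → Carrier
  a₂ Z = 1# + q * Z
  a₁ Z = (1# - q * q * q * Z * Z) * (1# + q * Z) * (1# + q * q * Z)
  b₁ Z = q * Z * (1# - q * q * q * Z * Z)
  a₀ Z = q * q * Z * Z * Z * (1# + q * q * Z)

  A₂ A₁ B₁ A₀ : ∀ {n} → Polynomial n → Polynomial n → Polynomial n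
  A₂ q Z = one :+ q :* Z
  A₁ q Z = (one :- q :* q :* q :* Z :* Z) :* (one :+ q :* Z) :* (one :+ q :* q :* Z)
  B₁ q Z = q :* Z :* (one :- q :* q :* q :* Z :* Z)
  A₀ q Z = q :* q :* Z :* Z :* Z :* (one :+ q :* q :* Z)

  ColumnRelation : Carrier → (y₂ y₁ y₁' y₀ : Carrier) → Set ℓ
  ColumnRelation Z y₂ y₁ y₁' y₀ = a₂ Z * y₂ ≈ a₁ Z * y₁ + - b₁ Z * y₁' + a₀ Z * y₀

  relation-cong : ∀ {Z Z' y₂ y₁ y₁' y₀ x₂ x₁ x₁' x₀} → Z ≈ Z' →
    y₂ ≈ x₂ → y₁ ≈ x₁ → y₁' ≈ x₁' → y₀ ≈ x₀ → ColumnRelation Z' x₂ x₁ x₁' x₀ → ColumnRelation Z y₂ y₁ y₁' y₀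
  relation-cong {Z} {Z'} Z≈Z' e₂ e₁ e₁' e₀ rel =
    trans (*-cong a₂≈ e₂) (trans rel (sym (+-cong (+-cong (*-cong a₁≈ e₁) (*-cong (-‿cong b₁≈) e₁')) (*-cong a₀≈ e₀))))
    where
    qZ≈ : q * Z ≈ q * Z'
    qZ≈ = *-congˡ Z≈Z'
    q³Z²≈ : q * q * q * Z * Z ≈ q * q * q * Z' * Z'
    q³Z²≈ = *-cong (*-congˡ Z≈Z') Z≈Z'
    a₂≈ : a₂ Z ≈ a₂ Z'
    a₂≈ = +-congˡ qZ≈
    a₁≈ : a₁ Z ≈ a₁ Z'
    a₁≈ = *-cong (*-cong (+-congˡ (-‿cong q³Z²≈)) a₂≈) (+-congˡ (*-congˡ Z≈Z'))
    b₁≈ : b₁ Z ≈ b₁ Z'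
    b₁≈ = *-cong qZ≈ (+-congˡ (-‿cong q³Z²≈))
    a₀≈ : a₀ Z ≈ a₀ Z'
    a₀≈ = *-cong (*-cong (*-cong (*-congˡ Z≈Z') Z≈Z') Z≈Z') (+-congˡ (*-congˡ Z≈Z'))

  relation-scale : ∀ {Z y₂ y₁ y₁' y₀} → ColumnRelation Z y₂ y₁ y₁' y₀ → ∀ W →
    ColumnRelation Z (y₂ * W) (y₁ * W) (y₁' * W) (y₀ * W)
  relation-scale {Z} {y₂} {y₁} {y₁'} {y₀} rel W = begin
    a₂ Z * (y₂ * W)                                                ≈⟨ *-assoc (a₂ Z) y₂ W ⟨
    a₂ Z * y₂ * W                                                  ≈⟨ *-congʳ rel ⟩
    (a₁ Z * y₁ + - b₁ Z * y₁' + a₀ Z * y₀) * W                     ≈⟨ ring-identity 7 (λ a g b y₁ y₁' y₀ W →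
                                                                        (a :* y₁ :+ g :* y₁' :+ b :* y₀) :* W
                                                                        := a :* (y₁ :* W) :+ g :* (y₁' :* W) :+ b :* (y₀ :* W))
                                                                        (a₁ Z) (- b₁ Z) (a₀ Z) y₁ y₁' y₀ W ⟩
    a₁ Z * (y₁ * W) + - b₁ Z * (y₁' * W) + a₀ Z * (y₀ * W)          ∎

  CoefficientRecurrence : (ℕ → ℕ → Carrier) → ℕ → ℕ → Set ℓ
  CoefficientRecurrence σ m k = ColumnRelation (pow q m)
    (coeff σ (suc (suc m)) k) (coeff σ (suc m) k) (shift (coeff σ (suc m)) k) (shift (shift (coeff σ m)) k)

  factor : ∀ {σ' σ₀ s' S K r} → σ' ≈ r * σ₀ → s' ≈ S * K → σ' * s' ≈ (r * S) * (σ₀ * K)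
  factor {σ'} {σ₀} {s'} {S} {K} {r} σ'≈ s'≈ = trans (*-cong σ'≈ s'≈)
    (ring-identity 4 (λ r σ S K → (r :* σ) :* (S :* K) := (r :* S) :* (σ :* K)) r σ₀ S K)

  factor₁ : ∀ {σ₀ s' S K} → s' ≈ S * K → σ₀ * s' ≈ S * (σ₀ * K)
  factor₁ {σ₀} {s'} {S} {K} s'≈ = trans (*-congˡ s'≈) (x∙yz≈y∙xz σ₀ S K)
    where open import Algebra.Properties.CommutativeSemigroup *-commutativeSemigroup using (x∙yz≈y∙xz)

  qfac-split : ∀ {a} w k {W} → a ≡ w ℕ.+ k → pow q w ≈ W → qfac a ≈ qfac w * poch q (q * W) k
  qfac-split w k a≡w+k q^w≈W =
    trans (qfac-≡ a≡w+k) (trans (sym (qfac-shift w k)) (*-congˡ (poch-cong q k (*-congˡ q^w≈W))))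

  V : ℕ → Carrier
  V m = pow q m * pow q m

  module ColumnZeroShapes (m : ℕ) where
    Z f i₀ i₂ K S₂ S₁ : Carrier
    Z = pow q m
    f = qfac (m ℕ.+ m)
    i₀ = qfac⁻¹ 0
    i₂ = qfac⁻¹ (suc (suc m))
    K = f * poch q (q * V m) 2 * i₀ * i₂
    S₂ = (1# - q * V m * pow q 2) * (1# - q * V m * pow q 3)
    S₁ = 1# - pow q (suc (suc m))

    private
      index₂ : ∀ m → suc (suc m) ℕ.+ suc (suc m) ≡ m ℕ.+ m ℕ.+ 4
      index₂ = solve-∀
      index₁ : ∀ m → suc m ℕ.+ suc m ≡ m ℕ.+ m ℕ.+ 2
      index₁ = solve-∀

    shape₂ : shape (suc (suc m)) 0 ≈ S₂ * K
    shape₂ = trans (*-congʳ (*-congʳ (qfac-split (m ℕ.+ m) 4 (index₂ m) (pow-+ q m m))))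
      (ring-identity 5 (λ q Z f i₀ i₂ → f :* Poch q (q :* (Z :* Z)) 4 :* i₀ :* i₂
         := ((one :- q :* (Z :* Z) :* Pow q 2) :* (one :- q :* (Z :* Z) :* Pow q 3)) :* (f :* Poch q (q :* (Z :* Z)) 2 :* i₀ :* i₂))
         q Z f i₀ i₂)

    shape₁ : shape (suc m) 0 ≈ S₁ * K
    shape₁ = trans (*-cong (*-congʳ (qfac-split (m ℕ.+ m) 2 (index₁ m) (pow-+ q m m))) (qfac⁻¹-step (suc m)))
      (ring-identity 6 (λ q Z f i₀ i₂ s → f :* Poch q (q :* (Z :* Z)) 2 :* i₀ :* (i₂ :* s)
         := s :* (f :* Poch q (q :* (Z :* Z)) 2 :* i₀ :* i₂)) q Z f i₀ i₂ S₁)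

  -- Column 0.  The weights of both families are constant there, and the
  -- relation reduces to  a₂ (1 - q³Z²)(1 - q⁴Z²) = a₁ (1 - q²Z).
  column-zero : ∀ σ m → σ (suc (suc m)) 0 ≈ σ (suc m) 0 → CoefficientRecurrence σ m 0
  column-zero σ m σ₂≈σ₁ = relation-cong refl
    (factor (trans σ₂≈σ₁ (sym (*-identityˡ _))) shape₂) (factor (sym (*-identityˡ _)) shape₁)
    (sym (zeroˡ W)) (sym (zeroˡ W))
    (relation-scale identity W)
    where
    open ColumnZeroShapes m
    W : Carrier
    W = σ (suc m) 0 * K
    identity : ColumnRelation Z (1# * S₂) (1# * S₁) 0# 0#
    identity = ring-identity 2 (λ q Z → A₂ q Z :* (one :* ((one :- q :* (Z :* Z) :* Pow q 2) :* (one :- q :* (Z :* Z) :* Pow q 3)))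
      := A₁ q Z :* (one :* (one :- q :* (q :* Z))) :+ :- B₁ q Z :* con (0 , 0) :+ A₀ q Z :* con (0 , 0)) q Z

  module ColumnOneShapes (m : ℕ) where
    Z f i₁ i K : Carrier
    Z = pow q m
    f = qfac (m ℕ.+ m)
    i₁ = qfac⁻¹ 1
    i = qfac⁻¹ (suc m)
    K = f * poch q (q * V m) 1 * i₁ * i

    private
      index₂ : ∀ m → suc m ℕ.+ suc (suc m) ≡ m ℕ.+ m ℕ.+ 3
      index₂ = solve-∀
      index₁ : ∀ m → m ℕ.+ suc m ≡ m ℕ.+ m ℕ.+ 1
      index₁ = solve-∀
      index₀ : ∀ m → suc m ℕ.+ suc m ≡ m ℕ.+ m ℕ.+ 2
      index₀ = solve-∀

    shape₂ : shape (suc (suc m)) 1 ≈ ((1# - q * V m * pow q 1) * (1# - q * V m * pow q 2)) * K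
    shape₂ = trans (*-congʳ (*-congʳ (qfac-split (m ℕ.+ m) 3 (index₂ m) (pow-+ q m m))))
      (ring-identity 5 (λ q Z f i₁ i → f :* Poch q (q :* (Z :* Z)) 3 :* i₁ :* i
         := ((one :- q :* (Z :* Z) :* Pow q 1) :* (one :- q :* (Z :* Z) :* Pow q 2)) :* (f :* Poch q (q :* (Z :* Z)) 1 :* i₁ :* i))
         q Z f i₁ i)

    shape₁ : shape (suc m) 1 ≈ (1# - q * Z) * K
    shape₁ = trans (*-cong (*-congʳ (qfac-split (m ℕ.+ m) 1 (index₁ m) (pow-+ q m m))) (qfac⁻¹-step m))
      (ring-identity 5 (λ q Z f i₁ i → f :* Poch q (q :* (Z :* Z)) 1 :* i₁ :* (i :* (one :- q :* Z))
         := (one :- q :* Z) :* (f :* Poch q (q :* (Z :* Z)) 1 :* i₁ :* i)) q Z f i₁ i)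

    shape₀ : shape (suc m) 0 ≈ ((1# - q * V m * pow q 1) * (1# - q * 1#)) * K
    shape₀ = trans (*-congʳ (*-cong (qfac-split (m ℕ.+ m) 2 (index₀ m) (pow-+ q m m)) (qfac⁻¹-step 0)))
      (ring-identity 5 (λ q Z f i₁ i → f :* Poch q (q :* (Z :* Z)) 2 :* (i₁ :* (one :- q :* one)) :* i
         := ((one :- q :* (Z :* Z) :* Pow q 1) :* (one :- q :* one)) :* (f :* Poch q (q :* (Z :* Z)) 1 :* i₁ :* i))
         q Z f i₁ i)

  column-one : ∀ σ m {r₂ r₁} → σ (suc (suc m)) 1 ≈ r₂ * σ (suc m) 0 → σ (suc m) 1 ≈ r₁ * σ (suc m) 0 →
    ColumnRelation (pow q m)
      (r₂ * ((1# - q * V m * pow q 1) * (1# - q * V m * pow q 2)))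
      (r₁ * (1# - q * pow q m))
      ((1# - q * V m * pow q 1) * (1# - q * 1#))
      0# →
    CoefficientRecurrence σ m 1
  column-one σ m σ₂≈ σ₁≈ identity = relation-cong refl
    (factor σ₂≈ shape₂) (factor σ₁≈ shape₁) (factor₁ shape₀) (sym (zeroˡ (σ (suc m) 0 * K)))
    (relation-scale identity (σ (suc m) 0 * K))
    where open ColumnOneShapes m

  module InteriorShapes (j d : ℕ) where
    m w : ℕ
    m = j ℕ.+ d
    w = j ℕ.+ (d ℕ.+ d)

    X Y f i τ K : Carrier
    X = pow q j
    Y = pow q d
    f = qfac w
    i = qfac⁻¹ (suc (suc j))
    τ = truncInv m j
    K = f * i * τ

    private
      q^w≈XYY : pow q w ≈ X * (Y * Y)
      q^w≈XYY = trans (pow-+ q j (d ℕ.+ d)) (*-congˡ (pow-+ q d d))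

      qfac-at : ∀ {a} x k → a ≡ x ℕ.+ (w ℕ.+ k) → qfac (a ∸ x) ≈ f * poch q (q * (X * (Y * Y))) k
      qfac-at x k a≡ = qfac-split w k (∸-index x (w ℕ.+ k) a≡) q^w≈XYY

      index₂ : ∀ j d → suc (suc (j ℕ.+ d)) ℕ.+ suc (suc (j ℕ.+ d)) ≡ suc (suc j) ℕ.+ (j ℕ.+ (d ℕ.+ d) ℕ.+ 2)
      index₂ = solve-∀
      index₁ : ∀ j d → suc (j ℕ.+ d) ℕ.+ suc (j ℕ.+ d) ≡ suc (suc j) ℕ.+ (j ℕ.+ (d ℕ.+ d) ℕ.+ 0)
      index₁ = solve-∀
      index₁' : ∀ j d → suc (j ℕ.+ d) ℕ.+ suc (j ℕ.+ d) ≡ suc j ℕ.+ (j ℕ.+ (d ℕ.+ d) ℕ.+ 1)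
      index₁' = solve-∀
      index₀ : ∀ j d → j ℕ.+ d ℕ.+ (j ℕ.+ d) ≡ j ℕ.+ (j ℕ.+ (d ℕ.+ d) ℕ.+ 0)
      index₀ = solve-∀

    shape₂ : shape (suc (suc m)) (suc (suc j)) ≈ poch q (q * (X * (Y * Y))) 2 * K
    shape₂ = trans (*-congʳ (*-congʳ (qfac-at (suc (suc j)) 2 (index₂ j d))))
      (ring-identity 4 (λ f p i τ → f :* p :* i :* τ := p :* (f :* i :* τ)) f (poch q (q * (X * (Y * Y))) 2) i τ)

    shape₁ : shape (suc m) (suc (suc j)) ≈ (1# - Y) * K
    shape₁ = trans (*-cong (*-congʳ (qfac-at (suc (suc j)) 0 (index₁ j d)))
                           (trans (truncInv-step m j) (*-congʳ (+-congˡ (-‿cong (pow-≡ q (ℕP.m+n∸m≡n j d)))))))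
      (ring-identity 4 (λ f i τ Y → f :* one :* i :* ((one :- Y) :* τ) := (one :- Y) :* (f :* i :* τ)) f i τ Y)

    shape₁' : shape (suc m) (suc j) ≈ (poch q (q * (X * (Y * Y))) 1 * (1# - q * (q * X))) * K
    shape₁' = trans (*-congʳ (*-cong (qfac-at (suc j) 1 (index₁' j d)) (qfac⁻¹-step (suc j))))
      (ring-identity 5 (λ f p i τ s → f :* p :* (i :* s) :* τ := (p :* s) :* (f :* i :* τ))
        f (poch q (q * (X * (Y * Y))) 1) i τ (1# - q * (q * X)))

    shape₀ : shape m j ≈ ((1# - q * (q * X)) * (1# - q * X)) * K
    shape₀ = trans (*-congʳ (*-cong (qfac-at j 0 (index₀ j d)) (qfac⁻¹-step₂ j)))
      (ring-identity 5 (λ f i τ s s' → f :* one :* (i :* s :* s') :* τ := (s :* s') :* (f :* i :* τ))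
        f i τ (1# - q * (q * X)) (1# - q * X))

  column-interior : ∀ σ j d {r₂ r₁ r₀} → let m = j ℕ.+ d ; X = pow q j ; Y = pow q d ; W = X * (Y * Y) in
    σ (suc (suc m)) (suc (suc j)) ≈ r₂ * σ m j → σ (suc m) (suc (suc j)) ≈ r₁ * σ m j →
    σ (suc m) (suc j) ≈ r₀ * σ m j →
    ColumnRelation (X * Y)
      (r₂ * poch q (q * W) 2)
      (r₁ * (1# - Y))
      (r₀ * (poch q (q * W) 1 * (1# - q * (q * X))))
      ((1# - q * (q * X)) * (1# - q * X)) →
    CoefficientRecurrence σ (j ℕ.+ d) (suc (suc j))
  column-interior σ j d σ₂≈ σ₁≈ σ₁'≈ identity = relation-cong (pow-+ q j d)
    (factor σ₂≈ shape₂) (factor σ₁≈ shape₁) (factor σ₁'≈ shape₁') (factor₁ shape₀)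
    (relation-scale identity (σ m j * K))
    where open InteriorShapes j d

  zero-relation : ∀ {Z} → ColumnRelation Z 0# 0# 0# 0#
  zero-relation {Z} = ring-identity 4 (λ u a g b → u :* con (0 , 0) := a :* con (0 , 0) :+ :- g :* con (0 , 0) :+ b :* con (0 , 0))
    (a₂ Z) (a₁ Z) (b₁ Z) (a₀ Z)

  -- Columns 0 and 1 and the interior columns determine all columns: those
  -- beyond the interior vanish identically.
  coefficient-recurrence : ∀ σ → (∀ m → CoefficientRecurrence σ m 0) → (∀ m → CoefficientRecurrence σ m 1) →
    (∀ j d → CoefficientRecurrence σ (j ℕ.+ d) (suc (suc j))) → ∀ m k → CoefficientRecurrence σ m k
  coefficient-recurrence σ col₀ col₁ interior m zero          = col₀ m
  coefficient-recurrence σ col₀ col₁ interior m (suc zero)    = col₁ m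
  coefficient-recurrence σ col₀ col₁ interior m (suc (suc j)) with j ℕP.≤? m
  ... | yes j≤m = P.subst (λ m → CoefficientRecurrence σ m (suc (suc j))) (ℕP.m+[n∸m]≡n j≤m) (interior j (m ∸ j))
  ... | no  j≰m = relation-cong refl (coeff-above σ (s≤s (s≤s m<j))) (coeff-above σ (s≤s (ℕP.m≤n⇒m≤1+n m<j)))
                    (coeff-above σ (s≤s m<j)) (coeff-above σ m<j) zero-relation
    where m<j = ℕP.≰⇒> j≰m

  SolvesRecurrence : (ℕ → Carrier → Carrier) → Set (c ⊔ ℓ)
  SolvesRecurrence y = ∀ m t → let Z = pow q m in
    a₂ Z * y (suc (suc m)) t ≈ (a₁ Z + - b₁ Z * t) * y (suc m) t + a₀ Z * (t * t) * y m t

  recurrence-resp : ∀ {y z} → (∀ n t → y n t ≈ z n t) → SolvesRecurrence z → SolvesRecurrence y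
  recurrence-resp y≈z rec m t = trans (*-congˡ (y≈z (suc (suc m)) t))
    (trans (rec m t) (sym (+-cong (*-congˡ (y≈z (suc m) t)) (*-congˡ (y≈z m t)))))

  coefficient-polynomials-recur : ∀ σ → (∀ m k → CoefficientRecurrence σ m k) → SolvesRecurrence (λ n → ev n (coeff σ n))
  coefficient-polynomials-recur σ rec m = recurrence-from-coefficients m _ _ _ _ (coeff σ m) (coeff σ (suc m)) (coeff σ (suc (suc m)))
    (coeff-above σ (ℕP.n<1+n (suc m))) (rec m)

  σB-step : ∀ n n' k → σB n (suc k) ≈ - pow q k * σB n' k
  σB-step n n' k = begin
    (- 1# * pow (- 1#) k) * pow q (choose2 (suc k))     ≈⟨ *-congˡ (trans (pow-≡ q (choose2-suc k)) (pow-+ q k (choose2 k))) ⟩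
    (- 1# * pow (- 1#) k) * (pow q k * pow q (choose2 k)) ≈⟨ ring-identity 3 (λ s Q C → (:- one :* s) :* (Q :* C) := :- Q :* (s :* C))
                                                               (pow (- 1#) k) (pow q k) (pow q (choose2 k)) ⟩
    - pow q k * σB n' k                                  ∎

  σB-step₂ : ∀ n n' k → σB n (suc (suc k)) ≈ (- pow q (suc k) * - pow q k) * σB n' k
  σB-step₂ n n' k = trans (σB-step n n (suc k)) (trans (*-congˡ (σB-step n n' k)) (sym (*-assoc _ _ _)))

  B-coefficients : ∀ m k → CoefficientRecurrence σB m k
  B-coefficients = coefficient-recurrence σB
    (λ m → column-zero σB m refl)
    (λ m → column-one σB m (σB-step (suc (suc m)) (suc m) 0) (σB-step (suc m) (suc m) 0)
      (ring-identity 2 (λ q Z → A₂ q Z :* (:- one :* ((one :- q :* (Z :* Z) :* Pow q 1) :* (one :- q :* (Z :* Z) :* Pow q 2)))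
        := A₁ q Z :* (:- one :* (one :- q :* Z)) :+ :- B₁ q Z :* ((one :- q :* (Z :* Z) :* Pow q 1) :* (one :- q :* one))
           :+ A₀ q Z :* con (0 , 0)) q (pow q m)))
    (λ j d → column-interior σB j d (σB-step₂ (suc (suc (j ℕ.+ d))) (j ℕ.+ d) j)
      (σB-step₂ (suc (j ℕ.+ d)) (j ℕ.+ d) j) (σB-step (suc (j ℕ.+ d)) (j ℕ.+ d) j)
      (ring-identity 3 (λ q X Y → A₂ q (X :* Y) :* ((:- (q :* X) :* :- X) :* Poch q (q :* (X :* (Y :* Y))) 2)
        := A₁ q (X :* Y) :* ((:- (q :* X) :* :- X) :* (one :- Y))
           :+ :- B₁ q (X :* Y) :* (:- X :* (Poch q (q :* (X :* (Y :* Y))) 1 :* (one :- q :* (q :* X))))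
           :+ A₀ q (X :* Y) :* ((one :- q :* (q :* X)) :* (one :- q :* X))) q (pow q j) (pow q d)))

  B-recurrence : SolvesRecurrence (B q)
  B-recurrence = recurrence-resp B-expansion (coefficient-polynomials-recur σB B-coefficients)

  σA-ratio : ∀ j d n k s t e → k ℕ.* n ≡ j ℕ.* (j ℕ.+ d) ℕ.+ (s ℕ.* j ℕ.+ (t ℕ.* d ℕ.+ e)) →
    σA n k ≈ (pow (pow q j) s * (pow (pow q d) t * pow q e)) * σA (j ℕ.+ d) j
  σA-ratio j d n k s t e exponent = begin
    pow q (k ℕ.* n)                                              ≈⟨ pow-≡ q exponent ⟩
    pow q (j ℕ.* (j ℕ.+ d) ℕ.+ (s ℕ.* j ℕ.+ (t ℕ.* d ℕ.+ e)))   ≈⟨ pow-+ q (j ℕ.* (j ℕ.+ d)) _ ⟩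
    σA (j ℕ.+ d) j * pow q (s ℕ.* j ℕ.+ (t ℕ.* d ℕ.+ e))        ≈⟨ *-congˡ (trans (pow-affine q j s _) (*-congˡ (pow-affine q d t e))) ⟩
    σA (j ℕ.+ d) j * (pow (pow q j) s * (pow (pow q d) t * pow q e)) ≈⟨ *-comm _ _ ⟩
    (pow (pow q j) s * (pow (pow q d) t * pow q e)) * σA (j ℕ.+ d) j ∎

  σA-column-one : ∀ n → σA n 1 ≈ pow q n * σA n 0
  σA-column-one n = trans (pow-≡ q (ℕP.*-identityˡ n)) (sym (*-identityʳ (pow q n)))

  A-coefficients : ∀ m k → CoefficientRecurrence σA m k
  A-coefficients = coefficient-recurrence σA
    (λ m → column-zero σA m refl)
    (λ m → column-one σA m (σA-column-one (suc (suc m))) (σA-column-one (suc m))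
      (ring-identity 2 (λ q Z → A₂ q Z :* ((q :* (q :* Z)) :* ((one :- q :* (Z :* Z) :* Pow q 1) :* (one :- q :* (Z :* Z) :* Pow q 2)))
        := A₁ q Z :* ((q :* Z) :* (one :- q :* Z)) :+ :- B₁ q Z :* ((one :- q :* (Z :* Z) :* Pow q 1) :* (one :- q :* one))
           :+ A₀ q Z :* con (0 , 0)) q (pow q m)))
    (λ j d → column-interior σA j d (σA-ratio j d (suc (suc (j ℕ.+ d))) (suc (suc j)) 4 2 4 (exponent₂ j d))
      (σA-ratio j d (suc (j ℕ.+ d)) (suc (suc j)) 3 2 2 (exponent₁ j d))
      (σA-ratio j d (suc (j ℕ.+ d)) (suc j) 2 1 1 (exponent₁' j d))
      (ring-identity 3 (λ q X Y → A₂ q (X :* Y) :* ((Pow X 4 :* (Pow Y 2 :* Pow q 4)) :* Poch q (q :* (X :* (Y :* Y))) 2)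
        := A₁ q (X :* Y) :* ((Pow X 3 :* (Pow Y 2 :* Pow q 2)) :* (one :- Y))
           :+ :- B₁ q (X :* Y) :* ((Pow X 2 :* (Pow Y 1 :* Pow q 1)) :* (Poch q (q :* (X :* (Y :* Y))) 1 :* (one :- q :* (q :* X))))
           :+ A₀ q (X :* Y) :* ((one :- q :* (q :* X)) :* (one :- q :* X))) q (pow q j) (pow q d)))
    where
    exponent₂ : ∀ j d → suc (suc j) ℕ.* suc (suc (j ℕ.+ d)) ≡ j ℕ.* (j ℕ.+ d) ℕ.+ (4 ℕ.* j ℕ.+ (2 ℕ.* d ℕ.+ 4))
    exponent₂ = solve-∀
    exponent₁ : ∀ j d → suc (suc j) ℕ.* suc (j ℕ.+ d) ≡ j ℕ.* (j ℕ.+ d) ℕ.+ (3 ℕ.* j ℕ.+ (2 ℕ.* d ℕ.+ 2))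
    exponent₁ = solve-∀
    exponent₁' : ∀ j d → suc j ℕ.* suc (j ℕ.+ d) ≡ j ℕ.* (j ℕ.+ d) ℕ.+ (2 ℕ.* j ℕ.+ (1 ℕ.* d ℕ.+ 1))
    exponent₁' = solve-∀

  A-recurrence : SolvesRecurrence (A q)
  A-recurrence = recurrence-resp A-expansion (coefficient-polynomials-recur σA A-coefficients)

  Δ-step : ∀ m t → a₂ (pow q m) * Δ q (suc m) t ≈ - (a₀ (pow q m) * (t * t)) * Δ q m t
  Δ-step m t = casoratian-step commutativeRing (B-recurrence m t) (A-recurrence m t)

  B-degree-0 : ∀ t → B q 0 t ≈ 1#
  B-degree-0 t = trans (*-congʳ (*-congʳ (*-congʳ (qbinom-zero 0))))
    (ring-identity 0 (one :* one :* one :* one := one))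

  A-degree-0 : ∀ t → A q 0 t ≈ 1#
  A-degree-0 t = trans (*-congʳ (*-congʳ (*-congʳ (qbinom-zero 0))))
    (ring-identity 0 (one :* one :* one :* one := one))

  B-degree-1 : ∀ t → B q 1 t ≈ 1# - q * q - t
  B-degree-1 t = trans (+-cong (*-congʳ (*-congʳ (*-congʳ (qbinom-zero 1)))) (*-congʳ (*-congʳ (*-congʳ (qbinom-diagonal 1)))))
    (ring-identity 2 (λ q t → one :* one :* (one :* (one :- q :* (q :* one) :* one)) :* one :+ one :* one :* one :* (:- t :* one)
      := one :- q :* q :- t) q t)

  A-degree-1 : ∀ t → A q 1 t ≈ 1# - q * q + q * t
  A-degree-1 t = trans (+-cong (*-congʳ (*-congʳ (*-congʳ (qbinom-zero 1)))) (*-congʳ (*-congʳ (*-congʳ (qbinom-diagonal 1)))))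
    (ring-identity 2 (λ q t → one :* one :* (one :* (one :- q :* (q :* one) :* one)) :* one :+ one :* (q :* one) :* one :* (t :* one)
      := one :- q :* q :+ q :* t) q t)

  D : ℕ → Carrier
  D n = pow (- 1#) n * pow q ((3 ℕ.* n ℕ.* n ℕ.+ n) / 2) * (1# + pow q (suc n))

  D≉0 : ∀ n → ¬ (D n ≈ 0#)
  D≉0 n = nonzero-* (nonzero-* (pow-nonzero n -1≉0) (pow-nonzero ((3 ℕ.* n ℕ.* n ℕ.+ n) / 2) q≉0)) (1+q^k≉0 n)

  Δ-base : ∀ t → Δ q 0 t ≈ D 0 * pow t 1
  Δ-base t = begin
    B q 0 t * A q 1 t - A q 0 t * B q 1 t                         ≈⟨ +-cong (*-cong (B-degree-0 t) (A-degree-1 t))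
                                                                          (-‿cong (*-cong (A-degree-0 t) (B-degree-1 t))) ⟩
    1# * (1# - q * q + q * t) - 1# * (1# - q * q - t)             ≈⟨ ring-identity 2 (λ q t →
                                                                         one :* (one :- q :* q :+ q :* t) :- one :* (one :- q :* q :- t)
                                                                         := one :* one :* (one :+ q :* one) :* (t :* one)) q t ⟩
    D 0 * pow t 1                                                  ∎

  pentagonal-power : ∀ m → pow q ((3 ℕ.* suc m ℕ.* suc m ℕ.+ suc m) / 2)
                           ≈ (pow (pow q m) 3 * pow q 2) * pow q ((3 ℕ.* m ℕ.* m ℕ.+ m) / 2)
  pentagonal-power m = trans (pow-≡ q (pentagonal-suc m))
    (trans (pow-+ q (3 ℕ.* m ℕ.+ 2) _) (*-congʳ (pow-affine q m 3 2)))

  odd-power-step : ∀ m t → pow t (suc (2 ℕ.* suc m)) ≈ pow t 2 * pow t (suc (2 ℕ.* m))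
  odd-power-step m t = trans (pow-≡ t (exponent m)) (pow-+ t 2 (suc (2 ℕ.* m)))
    where
    exponent : ∀ m → suc (2 ℕ.* suc m) ≡ 2 ℕ.+ suc (2 ℕ.* m)
    exponent = solve-∀

  -- Δ_n = D_n t^{2n+1}, by induction along Δ-step (a₂ = 1 + q^{m+1} is nonzero).
  Δ-closed-form : ∀ n t → Δ q n t ≈ D n * pow t (suc (2 ℕ.* n))
  Δ-closed-form zero    t = Δ-base t
  Δ-closed-form (suc m) t = *-cancelˡ (1+q^k≉0 m) (begin
    a₂ Z * Δ q (suc m) t                    ≈⟨ Δ-step m t ⟩
    - (a₀ Z * (t * t)) * Δ q m t            ≈⟨ *-congˡ (Δ-closed-form m t) ⟩
    - (a₀ Z * (t * t)) * (D m * τ)          ≈⟨ ring-identity 6 (λ q Z s E t T →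
                                                 :- (A₀ q Z :* (t :* t)) :* (s :* E :* (one :+ q :* Z) :* T)
                                                 := A₂ q Z :* ((:- one :* s) :* ((Pow Z 3 :* Pow q 2) :* E) :* (one :+ q :* (q :* Z)) :* (Pow t 2 :* T)))
                                                 q Z s E t τ ⟩
    a₂ Z * ((- 1# * s) * ((pow Z 3 * pow q 2) * E) * (1# + q * (q * Z)) * (pow t 2 * τ))
                                            ≈⟨ *-congˡ (*-cong (*-congʳ (*-congˡ (sym (pentagonal-power m)))) (sym (odd-power-step m t))) ⟩
    a₂ Z * (D (suc m) * pow t (suc (2 ℕ.* suc m))) ∎)
    where
    Z = pow q m
    s = pow (- 1#) m
    E = pow q ((3 ℕ.* m ℕ.* m ℕ.+ m) / 2)
    τ = pow t (suc (2 ℕ.* m))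

  -- The paper's constant C_n equals D_n: multiply both by 1 - q^{n+1} and use
  -- (q)_{n+1} (q^{n+2})_{n+1} = (q)_{2n+2} = (q)_{2n+1} (1 - q^{2n+2}).
  C≈D : ∀ n → C q n ≈ D n
  C≈D n = *-cancelˡ (1-q^k≉0 n) (begin
    (1# - K) * C q n                      ≈⟨ ring-identity 6 (λ K p s E f i → (one :- K) :* (p :* s :* E :* f :* i)
                                               := (f :* (one :- K) :* p) :* (s :* E :* i)) K p s E f i ⟩
    (qfac (suc n) * p) * (s * E * i)      ≈⟨ *-congʳ (trans (qfac-shift (suc n) (suc n)) (qfac-≡ (index n))) ⟩
    qfac (suc (suc (2 ℕ.* n))) * (s * E * i)
                                          ≈⟨ *-congʳ (*-congˡ (+-congˡ (-‿cong K²))) ⟩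
    (w * (1# - K * K)) * (s * E * i)      ≈⟨ ring-identity 5 (λ w K s E i → (w :* (one :- K :* K)) :* (s :* E :* i)
                                               := (w :* i) :* ((one :- K) :* (s :* E :* (one :+ K)))) w K s E i ⟩
    (w * i) * ((1# - K) * D n)            ≈⟨ trans (*-congʳ (inverseʳ w (qfac≉0 (suc (2 ℕ.* n))))) (*-identityˡ _) ⟩
    (1# - K) * D n                        ∎)
    where
    K = pow q (suc n)
    p = poch q (pow q (suc (suc n))) (suc n)
    s = pow (- 1#) n
    E = pow q ((3 ℕ.* n ℕ.* n ℕ.+ n) / 2)
    f = qfac n
    w = qfac (suc (2 ℕ.* n))
    i = w ⁻¹
    index : ∀ n → suc n ℕ.+ suc n ≡ suc (suc (2 ℕ.* n))
    index = solve-∀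
    K² : q * pow q (suc (2 ℕ.* n)) ≈ K * K
    K² = trans (pow-≡ q (P.sym (index n))) (pow-+ q (suc n) (suc n))

lemma4 : {c ℓ : Level} (F : Field c ℓ) → let open Field F in let open QDefs F in
    (q : Carrier) → ¬ (q ≈ 0#) → (∀ (k : ℕ) → ¬ (pow q (suc k) ≈ 1#)) →
    (n : ℕ) →
    (∀ (t : Carrier) → Δ q n t ≈ C q n * pow t (suc (2 ℕ.* n)))
    × ¬ (C q n ≈ 0#)
lemma4 F q q≉0 q^k≉1 n =
  (λ t → trans (Δ-closed-form n t) (*-congʳ (sym (C≈D n)))) ,
  (λ C≈0 → D≉0 n (trans (sym (C≈D n)) C≈0))
  where
  open Field F
  open QCalculus F q q≉0 q^k≉1
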